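{- Let $r\ge 3$ and $k\ge 0$ be integers. If $r$ is even and $k$ is odd, then the only $(K_{1,r};k)$-vertex stable graph $G$ of order $r+k+1$ with $\Delta(G)<r+k$ is $K_{r+k+1}^{r+k-1}$. Moreover, if $r$ is odd or $k$ is even, no graph $G$ of order $r+k+1$ with $\Delta(G)<r+k$ is $(K_{1,r};k)$-vertex stable.
   Context: Graphs are finite, undirected, simple. A graph $G$ is $(H;k)$-vertex stable if for every set $F$ of $k$ vertices of $G$, the graph $G-F$ (obtained by deleting the vertices of $F$ with their incident edges) contains a subgraph isomorphic to $H$. $K_{1,r}$ is the star with one center and $r\ge 3$ leaves. $\Delta(G)$ is the maximum degree. For even $n$, $K_n^{n-2}$ denotes the $(n-2)$-regular graph of order $n$ (i.e. the complete graph $K_n$ with a perfect matching removed). -}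

module Defs where

open import Data.Nat using (ℕ; zero; suc; _+_; _*_; _<_; _/_)
open import Data.Nat.Properties using (_≟_)
open import Data.Bool using (Bool; true; false; not; _∧_; if_then_else_)
open import Data.Fin using (Fin; toℕ)
open import Data.Fin.Subset using (Subset; inside; outside; ∣_∣; _∉_)
open import Data.Vec using (tabulate)
open import Data.Product using (Σ; ∃; _×_)
open import Relation.Nullary.Decidable using (⌊_⌋)
open import Relation.Binary.PropositionalEquality using (_≡_) renaming (sym to ≡-sym)
open import Relation.Nullary using (yes; no)
open import Data.Empty using (⊥-elim)
open import Function.Definitions using (Injective)

record Graph (n : ℕ) : Set where
  field
    adj   : Fin n → Fin n → Bool
    sym   : ∀ u v → adj u v ≡ adj v u
    irrfl : ∀ v → adj v v ≡ false
open Graph public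

degree : ∀ {n} → Graph n → Fin n → ℕ
degree G v = ∣ tabulate (λ u → if adj G v u then inside else outside) ∣

MaxDegreeLt : ∀ {n} → Graph n → ℕ → Set
MaxDegreeLt G d = ∀ v → degree G v < d

ContainsAvoiding : ∀ {m n} → Graph m → Graph n → Subset n → Set
ContainsAvoiding {m} {n} H G F =
  Σ (Fin m → Fin n) λ f →
    Injective _≡_ _≡_ f
    × (∀ v → f v ∉ F)
    × (∀ u v → adj H u v ≡ true → adj G (f u) (f v) ≡ true)

VertexStable : ∀ {m n} → Graph m → ℕ → Graph n → Set
VertexStable H k G = ∀ F → ∣ F ∣ ≡ k → ContainsAvoiding H G F

starAdj : ∀ {r} → Fin (suc r) → Fin (suc r) → Bool
starAdj Fin.zero Fin.zero = false
starAdj Fin.zero (Fin.suc _) = true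
starAdj (Fin.suc _) Fin.zero = true
starAdj (Fin.suc _) (Fin.suc _) = false

Star : (r : ℕ) → Graph (suc r)
Star r = record { adj = starAdj ; sym = s ; irrfl = i }
  where
  s : ∀ u v → starAdj u v ≡ starAdj v u
  s Fin.zero Fin.zero = _≡_.refl
  s Fin.zero (Fin.suc _) = _≡_.refl
  s (Fin.suc _) Fin.zero = _≡_.refl
  s (Fin.suc _) (Fin.suc _) = _≡_.refl
  i : ∀ v → starAdj v v ≡ false
  i Fin.zero = _≡_.refl
  i (Fin.suc _) = _≡_.refl

-- K_n minus the perfect matching {0,1},{2,3},... : u ~ v iff ⌊u/2⌋ ≠ ⌊v/2⌋.
-- (For even n this is the (n-2)-regular graph K_n^{n-2}.)
cmpmAdj : ∀ {n} → Fin n → Fin n → Bool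
cmpmAdj u v = not ⌊ (toℕ u / 2) ≟ (toℕ v / 2) ⌋

cmpmSym : ∀ {n} (u v : Fin n) → cmpmAdj u v ≡ cmpmAdj v u
cmpmSym u v with (toℕ u / 2) ≟ (toℕ v / 2) | (toℕ v / 2) ≟ (toℕ u / 2)
... | yes _ | yes _ = _≡_.refl
... | no _  | no _  = _≡_.refl
... | yes p | no q  = ⊥-elim (q (≡-sym p))
... | no q  | yes p = ⊥-elim (q (≡-sym p))

cmpmIrr : ∀ {n} (v : Fin n) → cmpmAdj v v ≡ false
cmpmIrr v with (toℕ v / 2) ≟ (toℕ v / 2)
... | yes _ = _≡_.refl
... | no q = ⊥-elim (q _≡_.refl)

KminusPM : (n : ℕ) → Graph n
KminusPM n = record { adj = cmpmAdj ; sym = cmpmSym ; irrfl = cmpmIrr }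

Iso : ∀ {n} → Graph n → Graph n → Set
Iso {n} G H = Σ (Fin n → Fin n) λ f →
  Injective _≡_ _≡_ f × (∀ y → ∃ λ x → f x ≡ y)
  × (∀ u v → adj G u v ≡ adj H (f u) (f v))

Even Odd : ℕ → Set
Even n = ∃ λ m → n ≡ 2 * m
Odd  n = ∃ λ m → n ≡ suc (2 * m)

-- Vertex stability says exactly that every (r+1)-set S contains a vertex adjacent to all
-- other vertices of S.  Call S undominated when every vertex of S has a non-neighbour in S;
-- then no (r+1)-set is undominated.  As Δ(G) < r + k, every vertex has a non-neighbour, so an
-- undominated set grows by one vertex or by a non-adjacent pair, and undominated sets of size
-- r exist; they are closed under non-adjacency.  For such an S and x ∈ S the set S - x is
-- dominated (else trade x for a non-adjacent pair outside S), which gives a vertex of S whose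
-- only non-neighbour is x.  This map is injective on S, hence onto, so every vertex of S has
-- exactly one non-neighbour.  A vertex v with two non-neighbours a, b is impossible, since the
-- undominated set {v, a, b} extends to such an S (this is where r ≥ 3 is used).  So the
-- non-edges form a perfect matching, G ≅ K_n minus a perfect matching, and n and r (the size
-- of a set closed under the matching) are even.  Conversely, in that graph every odd set
-- contains a vertex whose partner lies outside it, and that vertex dominates the set.
module Submission where

open import Data.Bool using (Bool; true; false; not; if_then_else_)
import Data.Bool.Properties as Bool
open import Data.Empty using (⊥; ⊥-elim)
open import Data.Fin using (Fin; zero; suc; toℕ; punchIn; opposite; cast; combine; remQuot)
open import Data.Fin.Properties
  using ( _≟_; _<?_; any?; toℕ-injective; toℕ<n; toℕ-cast; cast-involutive; punchIn-injective
        ; punchInᵢ≢i; injective⇒≤; cantor-schröder-bernstein; toℕ-combine; combine-injective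
        ; remQuot-combine; combine-remQuot )
  renaming (suc-injective to Fin-suc-injective)
open import Data.Fin.Subset
  using (Subset; inside; outside; ∣_∣; _∈_; _∉_; _⊆_; _∪_; _-_; ⁅_⁆; ∁; ⊤)
  renaming (⊥ to ∅)
open import Data.Fin.Subset.Properties
  using ( _∈?_; ∈⊤; ∣⊤∣≡n; ∪-identityʳ; p─⊥≡p; p⊆p∪q; q⊆p∪q; x∈p∪q⁻; x∈⁅x⁆; x∈⁅y⁆⇒x≡y
        ; p─q⊆p; x∈p∧x≢y⇒x∈p-y; x∉∁p⇒x∈p; x∈∁p⇒x∉p; ∣∁p∣≡n∸∣p∣; p⊆q⇒∣p∣≤∣q∣; ⊆-trans )
  renaming (∉⊥ to ∉∅; ∣⊥∣≡0 to ∣∅∣≡0)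
open import Data.Nat using (ℕ; zero; suc; _+_; _*_; _∸_; _/_; _≤_; _<_; s≤s; z≤n)
open import Data.Nat.Properties
  using ( suc-injective; +-suc; +-comm; *-comm; +-identityʳ; *-distribˡ-+; even≢odd; <-irrefl
        ; <-trans; <⇒≱; m≤m+n; m≤n+m; m+n∸m≡n; m+n∸n≡m; m≤n⇒∃[o]m+o≡n )
import Data.Nat.Properties as ℕ
open import Data.Nat.DivMod using (+-distrib-/-∣ˡ; m*n/n≡m; m<n⇒m/n≡0)
open import Data.Nat.Divisibility using (m∣m*n)
open import Data.Product using (∃; _×_; _,_; proj₁; proj₂; uncurry)
import Data.Product as Product
open import Data.Product.Properties using (,-injectiveˡ; ,-injectiveʳ)
open import Data.Sum using (_⊎_; inj₁; inj₂; [_,_])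
import Data.Sum as Sum
open import Data.Vec using (_∷_; here; there; tabulate)
open import Data.Vec.Properties using (lookup∘tabulate; lookup⇒[]=; []=⇒lookup)
open import Function.Base using (_∘_; id; case_of_)
open import Function.Bundles using (_⇔_; mk⇔; Equivalence)
open import Function.Definitions using (Injective)
open import Relation.Binary.PropositionalEquality
  using (_≡_; _≢_; refl; sym; trans; cong; cong₂; subst; module ≡-Reasoning)
open import Relation.Nullary using (¬_; Dec; does; yes; no; ¬?; _×-dec_)
open import Relation.Nullary.Decidable using (decidable-stable; dec-true; dec-false; isYes≗does)

open import Defs hiding (sym)

private variable
  m n : ℕ
  p : Subset n
  x : Fin n

even⇒1+odd : Even m → Odd (suc m)
even⇒1+odd (a , refl) = a , refl

odd⇒1+even : Odd m → Even (suc m)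
odd⇒1+even (a , refl) = suc a , sym (*-distribˡ-+ 2 1 a)

even+odd : ∀ {m n} → Even m → Odd n → Odd (m + n)
even+odd (a , refl) (b , refl) =
  a + b , trans (+-suc (2 * a) (2 * b)) (cong suc (sym (*-distribˡ-+ 2 a b)))

even+even : ∀ {m n} → Even m → Even n → Even (m + n)
even+even (a , refl) (b , refl) = a + b , sym (*-distribˡ-+ 2 a b)

even∧odd⇒⊥ : Even m → Odd m → ⊥
even∧odd⇒⊥ (a , m≡2a) (b , m≡1+2b) = even≢odd a b (trans (sym m≡2a) m≡1+2b)

x∉p⇒∣p∪⁅x⁆∣≡1+∣p∣ : x ∉ p → ∣ p ∪ ⁅ x ⁆ ∣ ≡ suc ∣ p ∣
x∉p⇒∣p∪⁅x⁆∣≡1+∣p∣ {x = zero}  {p = inside  ∷ p} x∉p = ⊥-elim (x∉p here)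
x∉p⇒∣p∪⁅x⁆∣≡1+∣p∣ {x = zero}  {p = outside ∷ p} _   = cong (λ q → suc ∣ q ∣) (∪-identityʳ p)
x∉p⇒∣p∪⁅x⁆∣≡1+∣p∣ {x = suc x} {p = inside  ∷ p} x∉p = cong suc (x∉p⇒∣p∪⁅x⁆∣≡1+∣p∣ (x∉p ∘ there))
x∉p⇒∣p∪⁅x⁆∣≡1+∣p∣ {x = suc x} {p = outside ∷ p} x∉p = x∉p⇒∣p∪⁅x⁆∣≡1+∣p∣ (x∉p ∘ there)

x∈p⇒1+∣p-x∣≡∣p∣ : x ∈ p → suc ∣ p - x ∣ ≡ ∣ p ∣
x∈p⇒1+∣p-x∣≡∣p∣ {x = zero}  {p = inside  ∷ p} _           = cong (λ q → suc ∣ q ∣) (p─⊥≡p p)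
x∈p⇒1+∣p-x∣≡∣p∣ {x = suc x} {p = inside  ∷ p} (there x∈p) = cong suc (x∈p⇒1+∣p-x∣≡∣p∣ x∈p)
x∈p⇒1+∣p-x∣≡∣p∣ {x = suc x} {p = outside ∷ p} (there x∈p) = x∈p⇒1+∣p-x∣≡∣p∣ x∈p

x∈p-y⇒x≢y : ∀ {x y} → x ∈ p - y → x ≢ y
x∈p-y⇒x≢y {p = s ∷ p} {y = zero}  (there _)   ()
x∈p-y⇒x≢y {p = s ∷ p} {y = suc y} here        ()
x∈p-y⇒x≢y {p = s ∷ p} {y = suc y} (there x∈p) refl = x∈p-y⇒x≢y x∈p refl

∈-∪⁅⁆⁻ : ∀ {x y} → x ∈ p ∪ ⁅ y ⁆ → x ∈ p ⊎ x ≡ y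
∈-∪⁅⁆⁻ {p = p} {y = y} x∈ = Sum.map₂ (x∈⁅y⁆⇒x≡y y) (x∈p∪q⁻ p ⁅ y ⁆ x∈)

∈-∪⁅⁆⁺ : ∀ y → y ∈ p ∪ ⁅ y ⁆
∈-∪⁅⁆⁺ {p = p} y = q⊆p∪q p ⁅ y ⁆ (x∈⁅x⁆ y)

∉-∪⁅⁆ : ∀ {x y} → x ∉ p → x ≢ y → x ∉ p ∪ ⁅ y ⁆
∉-∪⁅⁆ x∉p x≢y x∈ = [ x∉p , x≢y ] (∈-∪⁅⁆⁻ x∈)

∈-tabulate⁺ : ∀ {f : Fin n → Bool} → f x ≡ true → x ∈ tabulate f
∈-tabulate⁺ {x = x} {f = f} fx = lookup⇒[]= x (tabulate f) (trans (lookup∘tabulate f x) fx)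

∈-tabulate⁻ : ∀ {f : Fin n → Bool} → x ∈ tabulate f → f x ≡ true
∈-tabulate⁻ {x = x} {f = f} x∈ = trans (sym (lookup∘tabulate f x)) ([]=⇒lookup x∈)

enumerate : (p : Subset n) → Fin ∣ p ∣ → Fin n
enumerate (inside  ∷ p) zero    = zero
enumerate (inside  ∷ p) (suc i) = suc (enumerate p i)
enumerate (outside ∷ p) i       = suc (enumerate p i)

enumerate-∈ : ∀ (p : Subset n) i → enumerate p i ∈ p
enumerate-∈ (inside  ∷ p) zero    = here
enumerate-∈ (inside  ∷ p) (suc i) = there (enumerate-∈ p i)
enumerate-∈ (outside ∷ p) i       = there (enumerate-∈ p i)

enumerate-injective : ∀ (p : Subset n) → Injective _≡_ _≡_ (enumerate p)
enumerate-injective (inside  ∷ p) {zero}  {zero}  _  = refl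
enumerate-injective (inside  ∷ p) {suc i} {suc j} eq =
  cong suc (enumerate-injective p (Fin-suc-injective eq))
enumerate-injective (outside ∷ p) eq = enumerate-injective p (Fin-suc-injective eq)

index : x ∈ p → Fin ∣ p ∣
index here = zero
index {p = inside  ∷ p} (there x∈p) = suc (index x∈p)
index {p = outside ∷ p} (there x∈p) = index x∈p

enumerate-index : (x∈p : x ∈ p) → enumerate p (index x∈p) ≡ x
enumerate-index here = refl
enumerate-index {p = inside  ∷ p} (there x∈p) = cong suc (enumerate-index x∈p)
enumerate-index {p = outside ∷ p} (there x∈p) = cong suc (enumerate-index x∈p)

enumeration : ∣ p ∣ ≡ m → ∃ λ (e : Fin m → Fin n) → Injective _≡_ _≡_ e × (∀ i → e i ∈ p)
enumeration {p = p} refl = enumerate p , enumerate-injective p , enumerate-∈ p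

∣p∣≡1+m⇒nonempty : ∣ p ∣ ≡ suc m → ∃ λ x → x ∈ p
∣p∣≡1+m⇒nonempty size with e , _ , e∈p ← enumeration size = e zero , e∈p zero

injective⇒≤∣p∣ : ∀ {f : Fin m → Fin n} → Injective _≡_ _≡_ f → (∀ i → f i ∈ p) → m ≤ ∣ p ∣
injective⇒≤∣p∣ {p = p} {f = f} f-injective f-∈ = injective⇒≤ {f = index ∘ f-∈} λ {i} {j} eq →
  f-injective (begin
    f i                          ≡⟨ enumerate-index (f-∈ i) ⟨
    enumerate p (index (f-∈ i))  ≡⟨ cong (enumerate p) eq ⟩
    enumerate p (index (f-∈ j))  ≡⟨ enumerate-index (f-∈ j) ⟩
    f j                          ∎)
  where open ≡-Reasoning

injective∧m≡∣p∣⇒onto : ∀ {f : Fin m → Fin n} {x} → Injective _≡_ _≡_ f → (∀ i → f i ∈ p) →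
                        m ≡ ∣ p ∣ → x ∈ p → ∃ λ i → f i ≡ x
injective∧m≡∣p∣⇒onto {p = p} {f = f} {x} f-injective f-∈ refl x∈p with any? (λ i → f i ≟ x)
... | yes hit = hit
... | no  miss = ⊥-elim (<-irrefl refl (subst (_≤ ∣ p - x ∣) (sym (x∈p⇒1+∣p-x∣≡∣p∣ x∈p))
                   (injective⇒≤∣p∣ f-injective λ i → x∈p∧x≢y⇒x∈p-y (f-∈ i) (miss ∘ (i ,_)))))

∣p∣<n⇒∃∉ : ∀ {n} {p : Subset n} → ∣ p ∣ < n → ∃ λ x → x ∉ p
∣p∣<n⇒∃∉ {n} {p} ∣p∣<n with any? (λ x → ¬? (x ∈? p))
... | yes outside-p = outside-p
... | no  ⊤⊆p       = ⊥-elim (<⇒≱ ∣p∣<n (subst (_≤ ∣ p ∣) (∣⊤∣≡n n)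
                        (p⊆q⇒∣p∣≤∣q∣ {p = ⊤} λ {x} _ → decidable-stable (x ∈? p) (⊤⊆p ∘ (x ,_)))))

module _ {π : Fin n → Fin n} (π-involutive : ∀ x → π (π x) ≡ x) (π-fixpoint-free : ∀ x → π x ≢ x) where

  private
    π-injective : Injective _≡_ _≡_ π
    π-injective {x} {y} eq = trans (sym (π-involutive x)) (trans (cong π eq) (π-involutive y))

    Closed : Subset n → Set
    Closed p = ∀ {x} → x ∈ p → π x ∈ p

    p-x-πx-closed : Closed p → Closed (p - x - π x)
    p-x-πx-closed {p = p} {x = x} closed {y} y∈q =
      x∈p∧x≢y⇒x∈p-y (x∈p∧x≢y⇒x∈p-y (closed y∈p) πy≢x) (y≢x ∘ π-injective)
      where
      y∈p-x = p─q⊆p (p - x) ⁅ π x ⁆ y∈q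
      y∈p   = p─q⊆p p ⁅ x ⁆ y∈p-x
      y≢x   = x∈p-y⇒x≢y y∈p-x
      πy≢x : π y ≢ x
      πy≢x πy≡x = x∈p-y⇒x≢y y∈q (trans (sym (π-involutive y)) (cong π πy≡x))

    2+∣p-x-πx∣≡∣p∣ : Closed p → x ∈ p → suc (suc ∣ p - x - π x ∣) ≡ ∣ p ∣
    2+∣p-x-πx∣≡∣p∣ {p = p} {x = x} closed x∈p = begin
      suc (suc ∣ p - x - π x ∣) ≡⟨ cong suc (x∈p⇒1+∣p-x∣≡∣p∣ πx∈p-x) ⟩
      suc ∣ p - x ∣             ≡⟨ x∈p⇒1+∣p-x∣≡∣p∣ x∈p ⟩
      ∣ p ∣                     ∎
      where
      open ≡-Reasoning
      πx∈p-x = x∈p∧x≢y⇒x∈p-y (closed x∈p) (π-fixpoint-free x)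

    even-size : ∀ s {p} → ∣ p ∣ ≡ s → Closed p → Even s
    even-size zero _ _ = 0 , refl
    even-size (suc s) size closed with x , x∈p ← ∣p∣≡1+m⇒nonempty size
      with s | suc-injective (trans (2+∣p-x-πx∣≡∣p∣ closed x∈p) size)
    ... | zero   | ()
    ... | suc s′ | eq =
      odd⇒1+even (even⇒1+odd (even-size s′ (suc-injective eq) (p-x-πx-closed {x = x} closed)))

  closed⇒even : (∀ {x} → x ∈ p → π x ∈ p) → Even ∣ p ∣
  closed⇒even {p = p} = even-size ∣ p ∣ refl

-- Non-neighbours, degrees and dominating vertices

NonAdjacent : Graph n → Fin n → Fin n → Set
NonAdjacent G u v = u ≢ v × adj G u v ≡ false

neighbours : Graph n → Fin n → Subset n
neighbours G v = tabulate (λ u → if adj G v u then inside else outside)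

Dominated : Graph n → Subset n → Set
Dominated G S = ∃ λ c → c ∈ S × (∀ {u} → u ∈ S → u ≢ c → adj G c u ≡ true)

Undominated : Graph n → Subset n → Set
Undominated G S = ∀ {v} → v ∈ S → ∃ λ u → u ∈ S × NonAdjacent G v u

module _ (G : Graph n) where

  nonAdjacent? : ∀ u v → Dec (NonAdjacent G u v)
  nonAdjacent? u v = ¬? (u ≟ v) ×-dec (adj G u v Bool.≟ false)

  nonAdjacent-sym : ∀ {u v} → NonAdjacent G u v → NonAdjacent G v u
  nonAdjacent-sym (u≢v , ¬uv) = u≢v ∘ sym , trans (Graph.sym G _ _) ¬uv

  ¬nonAdjacent⇒adjacent : ∀ {u v} → u ≢ v → ¬ NonAdjacent G u v → adj G u v ≡ true
  ¬nonAdjacent⇒adjacent u≢v ¬uv = Bool.¬-not (¬uv ∘ (u≢v ,_))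

  ∈-neighbours⁺ : ∀ {v u} → adj G v u ≡ true → u ∈ neighbours G v
  ∈-neighbours⁺ vu = ∈-tabulate⁺ (cong (if_then inside else outside) vu)

  ∈-neighbours⁻ : ∀ {v u} → u ∈ neighbours G v → adj G v u ≡ true
  ∈-neighbours⁻ {v} {u} u∈N with adj G v u | ∈-tabulate⁻ u∈N
  ... | true | _ = refl

  nonNeighbour-in? : ∀ S v → Dec (∃ λ u → u ∈ S × NonAdjacent G v u)
  nonNeighbour-in? S v = any? (λ u → u ∈? S ×-dec nonAdjacent? v u)

  dominated⇒¬undominated : ∀ {S} → Dominated G S → ¬ Undominated G S
  dominated⇒¬undominated (c , c∈S , dominates) undominated
    with u , u∈S , c≢u , ¬cu ← undominated c∈S
    with () ← trans (sym ¬cu) (dominates u∈S (c≢u ∘ sym))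

  ¬undominated⇒dominated : ∀ {S} → ¬ Undominated G S → Dominated G S
  ¬undominated⇒dominated {S} ¬undominated with any? (λ c → c ∈? S ×-dec ¬? (nonNeighbour-in? S c))
  ... | yes (c , c∈S , isolated) =
    c , c∈S , λ u∈S u≢c → ¬nonAdjacent⇒adjacent (u≢c ∘ sym) (λ cu → isolated (_ , u∈S , cu))
  ... | no ¬isolated = ⊥-elim (¬undominated λ {v} v∈S →
    decidable-stable (nonNeighbour-in? S v) (λ none → ¬isolated (v , v∈S , none)))

  undominated-∪⁅⁆ : ∀ {S u v} → Undominated G S → u ∈ S → NonAdjacent G v u → Undominated G (S ∪ ⁅ v ⁆)
  undominated-∪⁅⁆ {S} {u} undominated u∈S vu w∈ with ∈-∪⁅⁆⁻ w∈
  ... | inj₁ w∈S  = Product.map₂ (Product.map₁ (p⊆p∪q ⁅ _ ⁆)) (undominated w∈S)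
  ... | inj₂ refl = u , p⊆p∪q ⁅ _ ⁆ u∈S , vu

  undominated-∪⁅⁆⁅⁆ : ∀ {S u v} → Undominated G S → NonAdjacent G v u →
                       Undominated G ((S ∪ ⁅ v ⁆) ∪ ⁅ u ⁆)
  undominated-∪⁅⁆⁅⁆ {S} {u} {v} undominated vu w∈ with ∈-∪⁅⁆⁻ w∈
  ... | inj₂ refl = v , p⊆p∪q ⁅ u ⁆ (∈-∪⁅⁆⁺ v) , nonAdjacent-sym vu
  ... | inj₁ w∈S∪v with ∈-∪⁅⁆⁻ w∈S∪v
  ...   | inj₂ refl = u , ∈-∪⁅⁆⁺ u , vu
  ...   | inj₁ w∈S  = Product.map₂ (Product.map₁ (p⊆p∪q ⁅ u ⁆ ∘ p⊆p∪q ⁅ v ⁆)) (undominated w∈S)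

module _ {N} (G : Graph (suc N)) where

  maxDegree<⇒nonNeighbour : MaxDegreeLt G N → ∀ v → ∃ (NonAdjacent G v)
  maxDegree<⇒nonNeighbour Δ<N v with any? (nonAdjacent? G v)
  ... | yes vu = vu
  ... | no ¬vu = ⊥-elim (<⇒≱ (Δ<N v) (injective⇒≤∣p∣ (punchIn-injective v _ _) adjacent))
    where
    adjacent : ∀ u → punchIn v u ∈ neighbours G v
    adjacent u = ∈-neighbours⁺ G (¬nonAdjacent⇒adjacent G (punchInᵢ≢i v u ∘ sym) (¬vu ∘ (punchIn v u ,_)))

  nonNeighbour⇒maxDegree< : (∀ v → ∃ (NonAdjacent G v)) → MaxDegreeLt G N
  nonNeighbour⇒maxDegree< nonNeighbour v = subst (degree G v <_) size (s≤s (p⊆q⇒∣p∣≤∣q∣ N⊆⊤-v-u))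
    where
    u      = proj₁ (nonNeighbour v)
    v≢u    = proj₁ (proj₂ (nonNeighbour v))
    ¬vu    = proj₂ (proj₂ (nonNeighbour v))
    u∈⊤-v  = x∈p∧x≢y⇒x∈p-y ∈⊤ (v≢u ∘ sym)

    size : suc ∣ ⊤ - v - u ∣ ≡ N
    size = suc-injective (trans (cong suc (x∈p⇒1+∣p-x∣≡∣p∣ u∈⊤-v))
                                (trans (x∈p⇒1+∣p-x∣≡∣p∣ (∈⊤ {x = v})) (∣⊤∣≡n (suc N))))

    N⊆⊤-v-u : neighbours G v ⊆ ⊤ - v - u
    N⊆⊤-v-u {w} w∈N = x∈p∧x≢y⇒x∈p-y (x∈p∧x≢y⇒x∈p-y ∈⊤ w≢v) w≢u
      where
      vw = ∈-neighbours⁻ G w∈N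
      w≢v : w ≢ v
      w≢v refl with () ← trans (sym vw) (irrfl G v)
      w≢u : w ≢ u
      w≢u refl with () ← trans (sym vw) ¬vu

module _ (G : Graph n) {r : ℕ} where

  star⇒dominated : ∀ {S} → ∣ S ∣ ≡ suc r → ContainsAvoiding (Star r) G (∁ S) → Dominated G S
  star⇒dominated {S} ∣S∣≡1+r (f , f-injective , f∉∁S , f-edges) = f zero , f∈S zero , dominates
    where
    f∈S : ∀ i → f i ∈ S
    f∈S i = x∉∁p⇒x∈p (f∉∁S i)

    dominates : ∀ {u} → u ∈ S → u ≢ f zero → adj G (f zero) u ≡ true
    dominates u∈S u≢c with injective∧m≡∣p∣⇒onto f-injective f∈S (sym ∣S∣≡1+r) u∈S
    ... | zero  , refl = ⊥-elim (u≢c refl)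
    ... | suc j , refl = f-edges zero (suc j) refl

  dominated⇒star : ∀ {F} → ∣ ∁ F ∣ ≡ suc r → Dominated G (∁ F) → ContainsAvoiding (Star r) G F
  dominated⇒star {F} ∣∁F∣≡1+r (c , c∈∁F , dominates) =
    star (enumeration (suc-injective (trans (x∈p⇒1+∣p-x∣≡∣p∣ c∈∁F) ∣∁F∣≡1+r)))
    where
    star : (∃ λ (e : Fin r → Fin n) → Injective _≡_ _≡_ e × (∀ i → e i ∈ ∁ F - c)) →
           ContainsAvoiding (Star r) G F
    star (e , e-injective , e∈) = f , f-injective , f∉F , f-edges
      where
      f : Fin (suc r) → Fin n
      f zero    = c
      f (suc i) = e i

      e≢c : ∀ i → e i ≢ c
      e≢c i = x∈p-y⇒x≢y (e∈ i)

      c-e : ∀ i → adj G c (e i) ≡ true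
      c-e i = dominates (p─q⊆p _ _ (e∈ i)) (e≢c i)

      f-injective : Injective _≡_ _≡_ f
      f-injective {zero}  {zero}  _  = refl
      f-injective {zero}  {suc j} eq = ⊥-elim (e≢c j (sym eq))
      f-injective {suc i} {zero}  eq = ⊥-elim (e≢c i eq)
      f-injective {suc i} {suc j} eq = cong suc (e-injective eq)

      f∉F : ∀ i → f i ∉ F
      f∉F zero    = x∈∁p⇒x∉p c∈∁F
      f∉F (suc i) = x∈∁p⇒x∉p (p─q⊆p _ _ (e∈ i))

      f-edges : ∀ u v → adj (Star r) u v ≡ true → adj G (f u) (f v) ≡ true
      f-edges zero    (suc j) _ = c-e j
      f-edges (suc i) zero    _ = trans (Graph.sym G _ _) (c-e i)

module _ {r k} (G : Graph (suc (r + k))) where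

  vertexStable⇒dominated : VertexStable (Star r) k G → ∀ {S} → ∣ S ∣ ≡ suc r → Dominated G S
  vertexStable⇒dominated stable {S} ∣S∣≡1+r = star⇒dominated G ∣S∣≡1+r (stable (∁ S) (begin
    ∣ ∁ S ∣               ≡⟨ ∣∁p∣≡n∸∣p∣ S ⟩
    suc (r + k) ∸ ∣ S ∣   ≡⟨ cong (suc (r + k) ∸_) ∣S∣≡1+r ⟩
    suc r + k ∸ suc r     ≡⟨ m+n∸m≡n (suc r) k ⟩
    k                     ∎))
    where open ≡-Reasoning

  dominated⇒vertexStable : (∀ {S} → ∣ S ∣ ≡ suc r → Dominated G S) → VertexStable (Star r) k G
  dominated⇒vertexStable dominated F ∣F∣≡k = dominated⇒star G ∣∁F∣≡1+r (dominated ∣∁F∣≡1+r)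
    where
    open ≡-Reasoning
    ∣∁F∣≡1+r : ∣ ∁ F ∣ ≡ suc r
    ∣∁F∣≡1+r = begin
      ∣ ∁ F ∣               ≡⟨ ∣∁p∣≡n∸∣p∣ F ⟩
      suc (r + k) ∸ ∣ F ∣   ≡⟨ cong (suc (r + k) ∸_) ∣F∣≡k ⟩
      suc r + k ∸ k         ≡⟨ m+n∸n≡m (suc r) k ⟩
      suc r                 ∎

-- Undominated sets force the non-edges to form a perfect matching

record ComplementOfPerfectMatching (G : Graph n) : Set where
  field
    partner             : Fin n → Fin n
    nonAdjacent-partner : ∀ v → NonAdjacent G v (partner v)
    nonAdjacent⇒partner : ∀ {v u} → NonAdjacent G v u → u ≡ partner v

  partner-involutive : ∀ v → partner (partner v) ≡ v
  partner-involutive v = sym (nonAdjacent⇒partner (nonAdjacent-sym G (nonAdjacent-partner v)))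

  partner-fixpoint-free : ∀ v → partner v ≢ v
  partner-fixpoint-free v = proj₁ (nonAdjacent-partner v) ∘ sym

  partner-injective : Injective _≡_ _≡_ partner
  partner-injective {u} {v} eq =
    trans (sym (partner-involutive u)) (trans (cong partner eq) (partner-involutive v))

module _ (G : Graph n) (nonNeighbour : ∀ v → ∃ (NonAdjacent G v)) where

  undominated-step : ∀ {T} → Undominated G T → ∣ T ∣ < n →
    ∃ λ T′ → T ⊆ T′ × Undominated G T′ × (∣ T′ ∣ ≡ suc ∣ T ∣ ⊎ ∣ T′ ∣ ≡ suc (suc ∣ T ∣))
  undominated-step {T} undominated ∣T∣<n
    with v , v∉T ← ∣p∣<n⇒∃∉ {p = T} ∣T∣<n
    with nonNeighbour-in? G T v
  ... | yes (u , u∈T , vu) =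
    T ∪ ⁅ v ⁆ , p⊆p∪q ⁅ v ⁆ , undominated-∪⁅⁆ G undominated u∈T vu , inj₁ (x∉p⇒∣p∪⁅x⁆∣≡1+∣p∣ v∉T)
  ... | no ¬vu with u , vu ← nonNeighbour v =
    (T ∪ ⁅ v ⁆) ∪ ⁅ u ⁆ , p⊆p∪q ⁅ u ⁆ ∘ p⊆p∪q ⁅ v ⁆ , undominated-∪⁅⁆⁅⁆ G undominated vu ,
    inj₂ (trans (x∉p⇒∣p∪⁅x⁆∣≡1+∣p∣ u∉T∪v) (cong suc (x∉p⇒∣p∪⁅x⁆∣≡1+∣p∣ v∉T)))
    where
    u∉T∪v : u ∉ T ∪ ⁅ v ⁆
    u∉T∪v = ∉-∪⁅⁆ (λ u∈T → ¬vu (u , u∈T , vu)) (proj₁ vu ∘ sym)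

module _ {r} (G : Graph n) (r<n : r < n) (nonNeighbour : ∀ v → ∃ (NonAdjacent G v))
         (dominated : ∀ {S} → ∣ S ∣ ≡ suc r → Dominated G S) where

  private
    no-undominated : ∀ {S} → ∣ S ∣ ≡ suc r → ¬ Undominated G S
    no-undominated ∣S∣≡1+r = dominated⇒¬undominated G (dominated ∣S∣≡1+r)

    extend-by : ∀ d {T} → Undominated G T → d + ∣ T ∣ ≡ r →
                ∃ λ S → T ⊆ S × Undominated G S × ∣ S ∣ ≡ r
    extend-by zero    undominated size = _ , id , undominated , size
    extend-by (suc d) {T} undominated size
      with undominated-step G nonNeighbour undominated
             (<-trans (subst (∣ T ∣ <_) size (s≤s (m≤n+m ∣ T ∣ d))) r<n)
    ... | T′ , T⊆T′ , undominated′ , inj₁ ∣T′∣≡1+∣T∣ =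
      Product.map₂ (Product.map₁ (⊆-trans T⊆T′))
        (extend-by d undominated′ (trans (cong (d +_) ∣T′∣≡1+∣T∣) (trans (+-suc d ∣ T ∣) size)))
    ... | T′ , T⊆T′ , undominated′ , inj₂ ∣T′∣≡2+∣T∣ with d
    ...   | zero   = ⊥-elim (no-undominated (trans ∣T′∣≡2+∣T∣ (cong suc size)) undominated′)
    ...   | suc d′ = Product.map₂ (Product.map₁ (⊆-trans T⊆T′)) (extend-by d′ undominated′ (begin
      d′ + ∣ T′ ∣               ≡⟨ cong (d′ +_) ∣T′∣≡2+∣T∣ ⟩
      d′ + suc (suc ∣ T ∣)      ≡⟨ +-suc d′ (suc ∣ T ∣) ⟩
      suc (d′ + suc ∣ T ∣)      ≡⟨ cong suc (+-suc d′ ∣ T ∣) ⟩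
      suc (suc (d′ + ∣ T ∣))    ≡⟨ size ⟩
      r                         ∎))
      where open ≡-Reasoning

  extend : ∀ {T} → Undominated G T → ∣ T ∣ ≤ r → ∃ λ S → T ⊆ S × Undominated G S × ∣ S ∣ ≡ r
  extend {T} undominated ∣T∣≤r with d , ∣T∣+d≡r ← m≤n⇒∃[o]m+o≡n ∣T∣≤r =
    extend-by d undominated (trans (+-comm d ∣ T ∣) ∣T∣+d≡r)

  module _ {S} (undominated : Undominated G S) (∣S∣≡r : ∣ S ∣ ≡ r) where

    nonNeighbour-closed : ∀ {u v} → u ∈ S → NonAdjacent G u v → v ∈ S
    nonNeighbour-closed {u} {v} u∈S uv = decidable-stable (v ∈? S) λ v∉S →
      no-undominated (trans (x∉p⇒∣p∪⁅x⁆∣≡1+∣p∣ v∉S) (cong suc ∣S∣≡r))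
        (undominated-∪⁅⁆ G undominated u∈S (nonAdjacent-sym G uv))

    -- Otherwise replacing x by a non-adjacent pair from outside S gives an undominated (r+1)-set.
    dominated-after-removal : ∀ {x} → x ∈ S → Dominated G (S - x)
    dominated-after-removal {x} x∈S = ¬undominated⇒dominated G λ undominated′ →
      no-undominated size (undominated-∪⁅⁆⁅⁆ G undominated′ ou)
      where
      outside-S = ∣p∣<n⇒∃∉ {p = S} (subst (_< n) (sym ∣S∣≡r) r<n)
      o   = proj₁ outside-S
      o∉S = proj₂ outside-S
      u   = proj₁ (nonNeighbour o)
      ou  = proj₂ (nonNeighbour o)

      u∉S : u ∉ S
      u∉S u∈S = o∉S (nonNeighbour-closed u∈S (nonAdjacent-sym G ou))

      size : ∣ ((S - x) ∪ ⁅ o ⁆) ∪ ⁅ u ⁆ ∣ ≡ suc r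
      size = trans (x∉p⇒∣p∪⁅x⁆∣≡1+∣p∣ (∉-∪⁅⁆ (u∉S ∘ p─q⊆p S ⁅ x ⁆) (proj₁ ou ∘ sym)))
               (cong suc (trans (x∉p⇒∣p∪⁅x⁆∣≡1+∣p∣ (o∉S ∘ p─q⊆p S ⁅ x ⁆))
                 (trans (x∈p⇒1+∣p-x∣≡∣p∣ x∈S) ∣S∣≡r)))

    private-nonNeighbour : ∀ {x} → x ∈ S → ∃ λ y → y ∈ S × (∀ {u} → NonAdjacent G y u → u ≡ x)
    private-nonNeighbour {x} x∈S = from-dominating-vertex (dominated-after-removal x∈S)
      where
      from-dominating-vertex : Dominated G (S - x) →
                               ∃ λ y → y ∈ S × (∀ {u} → NonAdjacent G y u → u ≡ x)
      from-dominating-vertex (y , y∈S-x , dominates) = y , y∈S , only-x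
        where
        y∈S : y ∈ S
        y∈S = p─q⊆p S ⁅ x ⁆ y∈S-x

        only-x : ∀ {u} → NonAdjacent G y u → u ≡ x
        only-x {u} (y≢u , ¬yu) = decidable-stable (u ≟ x) λ u≢x →
          let u∈S-x = x∈p∧x≢y⇒x∈p-y (nonNeighbour-closed y∈S (y≢u , ¬yu)) u≢x in
          case trans (sym ¬yu) (dominates u∈S-x (y≢u ∘ sym)) of λ ()

    -- The map x ↦ y of private-nonNeighbour is injective on S, hence onto S.
    unique-nonNeighbour-in : ∀ {v a b} → v ∈ S → NonAdjacent G v a → NonAdjacent G v b → a ≡ b
    unique-nonNeighbour-in {v} {a} {b} v∈S va vb = via (enumeration ∣S∣≡r)
      where
      via : (∃ λ (e : Fin r → Fin n) → Injective _≡_ _≡_ e × (∀ i → e i ∈ S)) → a ≡ b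
      via (e , e-injective , e∈S) = trans (only k (at-k va)) (sym (only k (at-k vb)))
        where
        ψ : Fin r → Fin n
        ψ i = proj₁ (private-nonNeighbour (e∈S i))

        ψ∈S : ∀ i → ψ i ∈ S
        ψ∈S i = proj₁ (proj₂ (private-nonNeighbour (e∈S i)))

        only : ∀ i {u} → NonAdjacent G (ψ i) u → u ≡ e i
        only i = proj₂ (proj₂ (private-nonNeighbour (e∈S i)))

        ψ-injective : Injective _≡_ _≡_ ψ
        ψ-injective {i} {j} ψi≡ψj =
          e-injective (trans (sym (only i ψi-w)) (only j (subst (λ y → NonAdjacent G y w) ψi≡ψj ψi-w)))
          where
          w    = proj₁ (undominated (ψ∈S i))
          ψi-w = proj₂ (proj₂ (undominated (ψ∈S i)))

        v-hit = injective∧m≡∣p∣⇒onto ψ-injective ψ∈S (sym ∣S∣≡r) v∈S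
        k     = proj₁ v-hit

        at-k : ∀ {u} → NonAdjacent G v u → NonAdjacent G (ψ k) u
        at-k = subst (λ y → NonAdjacent G y _) (sym (proj₂ v-hit))

  unique-nonNeighbour : 3 ≤ r → ∀ {v a b} → NonAdjacent G v a → NonAdjacent G v b → a ≡ b
  unique-nonNeighbour 3≤r {v} {a} {b} va vb = decidable-stable (a ≟ b) λ a≢b →
    a≢b (unique-in (extend undominated-T (subst (_≤ r) (sym (∣T∣≡3 a≢b)) 3≤r)))
    where
    V A T : Subset n
    V = ∅ ∪ ⁅ v ⁆
    A = V ∪ ⁅ a ⁆
    T = A ∪ ⁅ b ⁆

    v∈A : v ∈ A
    v∈A = p⊆p∪q ⁅ a ⁆ (∈-∪⁅⁆⁺ v)

    undominated-T : Undominated G T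
    undominated-T = undominated-∪⁅⁆ G (undominated-∪⁅⁆⁅⁆ G (⊥-elim ∘ ∉∅) va) v∈A (nonAdjacent-sym G vb)

    ∣T∣≡3 : a ≢ b → ∣ T ∣ ≡ 3
    ∣T∣≡3 a≢b = begin
      ∣ T ∣             ≡⟨ x∉p⇒∣p∪⁅x⁆∣≡1+∣p∣ (∉-∪⁅⁆ (∉-∪⁅⁆ ∉∅ (proj₁ vb ∘ sym)) (a≢b ∘ sym)) ⟩
      suc ∣ A ∣         ≡⟨ cong suc (x∉p⇒∣p∪⁅x⁆∣≡1+∣p∣ (∉-∪⁅⁆ ∉∅ (proj₁ va ∘ sym))) ⟩
      2 + ∣ V ∣         ≡⟨ cong (2 +_) (x∉p⇒∣p∪⁅x⁆∣≡1+∣p∣ {p = ∅ {n = n}} ∉∅) ⟩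
      3 + ∣ ∅ {n = n} ∣ ≡⟨ cong (3 +_) (∣∅∣≡0 n) ⟩
      3                 ∎
      where open ≡-Reasoning

    unique-in : (∃ λ S → T ⊆ S × Undominated G S × ∣ S ∣ ≡ r) → a ≡ b
    unique-in (S , T⊆S , undominated-S , ∣S∣≡r) =
      unique-nonNeighbour-in undominated-S ∣S∣≡r (T⊆S (p⊆p∪q ⁅ b ⁆ v∈A)) va vb

  complementOfPerfectMatching : 3 ≤ r → ComplementOfPerfectMatching G
  complementOfPerfectMatching 3≤r = record
    { partner             = proj₁ ∘ nonNeighbour
    ; nonAdjacent-partner = proj₂ ∘ nonNeighbour
    ; nonAdjacent⇒partner = λ {v} vu → unique-nonNeighbour 3≤r vu (proj₂ (nonNeighbour v))
    }

  r-even : 3 ≤ r → Even r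
  r-even 3≤r
    with S , _ , undominated-S , ∣S∣≡r ← extend (⊥-elim ∘ ∉∅) (subst (_≤ r) (sym (∣∅∣≡0 n)) z≤n) =
    subst Even ∣S∣≡r (closed⇒even partner-involutive partner-fixpoint-free λ v∈S →
      nonNeighbour-closed undominated-S ∣S∣≡r v∈S (nonAdjacent-partner _))
    where open ComplementOfPerfectMatching (complementOfPerfectMatching 3≤r)

-- Complete multipartite graphs and K_n minus a perfect matching

CompleteMultipartite : Graph n → (Fin n → ℕ) → Set
CompleteMultipartite G part = ∀ u v → adj G u v ≡ false ⇔ part u ≡ part v

KminusPM-multipartite : CompleteMultipartite (KminusPM n) (λ y → toℕ y / 2)
KminusPM-multipartite y z = mk⇔
  (λ ¬yz → decidable-stable same? λ different →
    case trans (sym ¬yz) (cong not (trans (isYes≗does same?) (dec-false same? different))) of λ ())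
  (λ same → cong not (trans (isYes≗does same?) (dec-true same? same)))
  where same? = toℕ y / 2 ℕ.≟ toℕ z / 2

multipartite-iso : ∀ {G H : Graph n} {β γ} → CompleteMultipartite G β → CompleteMultipartite H γ →
  (f : Fin n → Fin n) → Injective _≡_ _≡_ f → (∀ y → ∃ λ x → f x ≡ y) → (∀ u → γ (f u) ≡ β u) → Iso G H
multipartite-iso {G = G} {H} {β} {γ} G-parts H-parts f f-injective f-surjective γ∘f≡β =
  f , f-injective , f-surjective , adj-preserved
  where
  same-part : ∀ u v → γ (f u) ≡ γ (f v) ⇔ β u ≡ β v
  same-part u v = mk⇔ (λ eq → trans (sym (γ∘f≡β u)) (trans eq (γ∘f≡β v)))
                      (λ eq → trans (γ∘f≡β u) (trans eq (sym (γ∘f≡β v))))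

  adj-preserved : ∀ u v → adj G u v ≡ adj H (f u) (f v)
  adj-preserved u v with adj G u v in Guv | adj H (f u) (f v) in Hfuv
  ... | true  | true  = refl
  ... | false | false = refl
  ... | true  | false = case trans (sym Guv) (Equivalence.from (G-parts u v)
          (Equivalence.to (same-part u v) (Equivalence.to (H-parts (f u) (f v)) Hfuv))) of λ ()
  ... | false | true  = case trans (sym Hfuv) (Equivalence.from (H-parts (f u) (f v))
          (Equivalence.from (same-part u v) (Equivalence.to (G-parts u v) Guv))) of λ ()

iso⇒complement : ∀ {n} {G H : Graph n} → Iso G H →
                 ComplementOfPerfectMatching H → ComplementOfPerfectMatching G
iso⇒complement {n} {G} {H} (f , f-injective , f-surjective , f-adj) H-complement = record
  { partner             = λ u → f⁻¹ (partner (f u))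
  ; nonAdjacent-partner = λ u →
      reflect (subst (NonAdjacent H (f u)) (sym (f∘f⁻¹ _)) (nonAdjacent-partner (f u)))
  ; nonAdjacent⇒partner = λ uv → f-injective (trans (nonAdjacent⇒partner (preserve uv)) (sym (f∘f⁻¹ _)))
  }
  where
  open ComplementOfPerfectMatching H-complement

  f⁻¹ : Fin n → Fin n
  f⁻¹ y = proj₁ (f-surjective y)

  f∘f⁻¹ : ∀ y → f (f⁻¹ y) ≡ y
  f∘f⁻¹ y = proj₂ (f-surjective y)

  preserve : ∀ {u v} → NonAdjacent G u v → NonAdjacent H (f u) (f v)
  preserve {u} {v} (u≢v , ¬uv) = u≢v ∘ f-injective , trans (sym (f-adj u v)) ¬uv

  reflect : ∀ {u v} → NonAdjacent H (f u) (f v) → NonAdjacent G u v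
  reflect {u} {v} (fu≢fv , ¬fufv) = fu≢fv ∘ cong f , trans (f-adj u v) ¬fufv

opposite≢ : ∀ (s : Fin 2) → opposite s ≢ s
opposite≢ zero       ()
opposite≢ (suc zero) ()

≢⇒opposite : ∀ {s t : Fin 2} → s ≢ t → t ≡ opposite s
≢⇒opposite {zero}     {zero}     s≢t = ⊥-elim (s≢t refl)
≢⇒opposite {zero}     {suc zero} _   = refl
≢⇒opposite {suc zero} {zero}     _   = refl
≢⇒opposite {suc zero} {suc zero} s≢t = ⊥-elim (s≢t refl)

-- Fin n ≅ Fin h × Fin 2, where the block of y is ⌊ y / 2 ⌋.
module Blocks {h} (n≡h*2 : n ≡ h * 2) where

  split : Fin n → Fin h × Fin 2
  split y = remQuot {h} 2 (cast n≡h*2 y)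

  join : Fin h → Fin 2 → Fin n
  join q s = cast (sym n≡h*2) (combine q s)

  split-join : ∀ q s → split (join q s) ≡ (q , s)
  split-join q s = trans (cong (remQuot {h} 2) (cast-involutive n≡h*2 (sym n≡h*2) (combine q s)))
                         (remQuot-combine q s)

  join-split : ∀ y → uncurry join (split y) ≡ y
  join-split y = trans (cong (cast (sym n≡h*2)) (combine-remQuot {h} 2 (cast n≡h*2 y)))
                       (cast-involutive (sym n≡h*2) n≡h*2 y)

  toℕ-join/2 : ∀ q s → toℕ (join q s) / 2 ≡ toℕ q
  toℕ-join/2 q s = begin
    toℕ (join q s) / 2          ≡⟨ cong (_/ 2) (trans (toℕ-cast _ (combine q s)) (toℕ-combine q s)) ⟩
    (2 * toℕ q + toℕ s) / 2     ≡⟨ +-distrib-/-∣ˡ (toℕ s) (m∣m*n (toℕ q)) ⟩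
    2 * toℕ q / 2 + toℕ s / 2   ≡⟨ cong₂ _+_ (trans (cong (_/ 2) (*-comm 2 (toℕ q))) (m*n/n≡m (toℕ q) 2))
                                             (m<n⇒m/n≡0 (toℕ<n s)) ⟩
    toℕ q + 0                   ≡⟨ +-identityʳ (toℕ q) ⟩
    toℕ q                       ∎
    where open ≡-Reasoning

  KminusPM-complement : ComplementOfPerfectMatching (KminusPM n)
  KminusPM-complement = record
    { partner             = partner
    ; nonAdjacent-partner = nonAdjacent-partner
    ; nonAdjacent⇒partner = nonAdjacent⇒partner
    }
    where
    block : Fin n → Fin h
    block y = proj₁ (split y)

    side : Fin n → Fin 2
    side y = proj₂ (split y)

    partner : Fin n → Fin n
    partner y = join (block y) (opposite (side y))

    toℕ/2≡block : ∀ y → toℕ y / 2 ≡ toℕ (block y)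
    toℕ/2≡block y = trans (cong (λ z → toℕ z / 2) (sym (join-split y))) (toℕ-join/2 _ _)

    block∧side⇒≡ : ∀ {y z} → block y ≡ block z → side y ≡ side z → y ≡ z
    block∧side⇒≡ {y} {z} eq₁ eq₂ = trans (sym (join-split y)) (trans (cong₂ join eq₁ eq₂) (join-split z))

    nonAdjacent-partner : ∀ y → NonAdjacent (KminusPM n) y (partner y)
    nonAdjacent-partner y = y≢partner , Equivalence.from (KminusPM-multipartite y (partner y)) (begin
      toℕ y / 2               ≡⟨ toℕ/2≡block y ⟩
      toℕ (block y)           ≡⟨ toℕ-join/2 (block y) (opposite (side y)) ⟨
      toℕ (partner y) / 2     ∎)
      where
      open ≡-Reasoning
      y≢partner : y ≢ partner y
      y≢partner eq = opposite≢ (side y) (sym (,-injectiveʳ (trans (cong split eq) (split-join _ _))))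

    nonAdjacent⇒partner : ∀ {y z} → NonAdjacent (KminusPM n) y z → z ≡ partner y
    nonAdjacent⇒partner {y} {z} (y≢z , ¬yz) =
      trans (sym (join-split z))
            (cong₂ join same-block (≢⇒opposite (y≢z ∘ block∧side⇒≡ (sym same-block))))
      where
      same-block : block z ≡ block y
      same-block = toℕ-injective (begin
        toℕ (block z)   ≡⟨ toℕ/2≡block z ⟨
        toℕ z / 2       ≡⟨ Equivalence.to (KminusPM-multipartite y z) ¬yz ⟨
        toℕ y / 2       ≡⟨ toℕ/2≡block y ⟩
        toℕ (block y)   ∎)
        where open ≡-Reasoning

pairing⇒n≡h*2 : ∀ {n h} (pos : Fin n → Fin h × Fin 2) → Injective _≡_ _≡_ pos →
                (∀ p → ∃ λ x → pos x ≡ p) → n ≡ h * 2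
pairing⇒n≡h*2 {n} {h} pos pos-injective pos-surjective =
  cantor-schröder-bernstein {f = uncurry combine ∘ pos} {g = pos⁻¹ ∘ remQuot {h} 2}
    (λ eq → pos-injective (uncurry (cong₂ _,_) (combine-injective _ _ _ _ eq)))
    (λ {x} {y} eq → begin
      x                                  ≡⟨ combine-remQuot {h} 2 x ⟨
      uncurry combine (remQuot {h} 2 x)  ≡⟨ cong (uncurry combine) (pos∘pos⁻¹ x y eq) ⟩
      uncurry combine (remQuot {h} 2 y)  ≡⟨ combine-remQuot {h} 2 y ⟩
      y                                  ∎)
  where
  open ≡-Reasoning
  pos⁻¹ : Fin h × Fin 2 → Fin n
  pos⁻¹ p = proj₁ (pos-surjective p)

  pos∘pos⁻¹ : ∀ x y → pos⁻¹ (remQuot {h} 2 x) ≡ pos⁻¹ (remQuot 2 y) → remQuot {h} 2 x ≡ remQuot 2 y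
  pos∘pos⁻¹ x y eq =
    trans (sym (proj₂ (pos-surjective _))) (trans (cong pos eq) (proj₂ (pos-surjective _)))

pairing-iso : ∀ {n} {G : Graph n} {h} (pos : Fin n → Fin h × Fin 2) → Injective _≡_ _≡_ pos →
              (∀ p → ∃ λ x → pos x ≡ p) → CompleteMultipartite G (toℕ ∘ proj₁ ∘ pos) → Iso G (KminusPM n)
pairing-iso {n} {G} {h} pos pos-injective pos-surjective G-parts =
  multipartite-iso {G = G} {KminusPM n} {toℕ ∘ proj₁ ∘ pos} {λ y → toℕ y / 2}
    G-parts KminusPM-multipartite f f-injective f-surjective (λ u → toℕ-join/2 (proj₁ (pos u)) (proj₂ (pos u)))
  where
  n≡h*2 : n ≡ h * 2
  n≡h*2 = pairing⇒n≡h*2 pos pos-injective pos-surjective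
  open Blocks {h = h} n≡h*2

  f : Fin n → Fin n
  f = uncurry join ∘ pos

  f-injective : Injective _≡_ _≡_ f
  f-injective eq = pos-injective (trans (sym (split-join _ _)) (trans (cong split eq) (split-join _ _)))

  f-surjective : ∀ y → ∃ λ x → f x ≡ y
  f-surjective y = proj₁ preimage , trans (cong (uncurry join) (proj₂ preimage)) (join-split y)
    where preimage = pos-surjective (split y)

module _ {G : Graph n} (complement : ComplementOfPerfectMatching G) where
  open ComplementOfPerfectMatching complement

  even-order : Even n
  even-order = subst Even (∣⊤∣≡n n) (closed⇒even partner-involutive partner-fixpoint-free (λ _ → ∈⊤))

  odd⇒dominated : ∀ {S} → Odd ∣ S ∣ → Dominated G S
  odd⇒dominated {S} odd with any? (λ c → c ∈? S ×-dec ¬? (partner c ∈? S))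
  ... | yes (c , c∈S , pc∉S) = c , c∈S , λ {u} u∈S u≢c →
    ¬nonAdjacent⇒adjacent G (u≢c ∘ sym) λ cu → pc∉S (subst (_∈ S) (nonAdjacent⇒partner cu) u∈S)
  ... | no ¬c = ⊥-elim (even∧odd⇒⊥ (closed⇒even partner-involutive partner-fixpoint-free closed) odd)
    where
    closed : ∀ {v} → v ∈ S → partner v ∈ S
    closed {v} v∈S = decidable-stable (partner v ∈? S) (λ pv∉S → ¬c (v , v∈S , pv∉S))

  -- A pair {v, partner v} is labelled by the position in Lower of its smaller end, its anchor;
  -- side v records which end of the pair v is.
  private
    Lower : Subset n
    Lower = tabulate (λ v → does (v <? partner v))

    lower⁺ : ∀ {v} → toℕ v < toℕ (partner v) → v ∈ Lower
    lower⁺ {v} v<pv = ∈-tabulate⁺ (dec-true (v <? partner v) v<pv)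

    lower⁻ : ∀ {v} → v ∈ Lower → toℕ v < toℕ (partner v)
    lower⁻ {v} v∈L = decidable-stable (v <? partner v) λ v≮pv →
      case trans (sym (∈-tabulate⁻ v∈L)) (dec-false (v <? partner v) v≮pv) of λ ()

    partner-lower : ∀ {v} → ¬ toℕ v < toℕ (partner v) → toℕ (partner v) < toℕ (partner (partner v))
    partner-lower {v} v≮pv = subst (λ w → toℕ (partner v) < toℕ w) (sym (partner-involutive v))
                               (ℕ.≤∧≢⇒< (ℕ.≮⇒≥ v≮pv) (partner-fixpoint-free v ∘ toℕ-injective))

    anchor : Fin n → Fin n
    anchor v with v <? partner v
    ... | yes _ = v
    ... | no  _ = partner v

    side : Fin n → Fin 2
    side v with v <? partner v
    ... | yes _ = zero
    ... | no  _ = suc zero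

    anchor∈Lower : ∀ v → anchor v ∈ Lower
    anchor∈Lower v with v <? partner v
    ... | yes v<pv = lower⁺ v<pv
    ... | no  v≮pv = lower⁺ (partner-lower v≮pv)

    anchor-cases : ∀ v → anchor v ≡ v ⊎ anchor v ≡ partner v
    anchor-cases v with v <? partner v
    ... | yes _ = inj₁ refl
    ... | no  _ = inj₂ refl

    anchor-of-lower : ∀ {w} → toℕ w < toℕ (partner w) → anchor w ≡ w × side w ≡ zero
    anchor-of-lower {w} w<pw with w <? partner w
    ... | yes _    = refl , refl
    ... | no  w≮pw = ⊥-elim (w≮pw w<pw)

    anchor-partner : ∀ v → anchor (partner v) ≡ anchor v × side (partner v) ≢ side v
    anchor-partner v with v <? partner v | partner v <? partner (partner v)
    ... | yes v<pv | yes pv<ppv = ⊥-elim (ℕ.<-asym v<pv (subst (λ w → toℕ (partner v) < toℕ w)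
                                                                (partner-involutive v) pv<ppv))
    ... | yes _    | no  _      = partner-involutive v , λ ()
    ... | no  _    | yes _      = refl , λ ()
    ... | no  v≮pv | no  pv≮ppv = ⊥-elim (pv≮ppv (partner-lower v≮pv))

    same-anchor : ∀ {u v} → anchor u ≡ anchor v → u ≡ v ⊎ v ≡ partner u
    same-anchor {u} {v} eq with anchor-cases u | anchor-cases v
    ... | inj₁ au≡u  | inj₁ av≡v  = inj₁ (trans (sym au≡u) (trans eq av≡v))
    ... | inj₁ au≡u  | inj₂ av≡pv = inj₂ (trans (sym (partner-involutive v))
                                      (cong partner (trans (sym av≡pv) (trans (sym eq) au≡u))))
    ... | inj₂ au≡pu | inj₁ av≡v  = inj₂ (trans (sym av≡v) (trans (sym eq) au≡pu))
    ... | inj₂ au≡pu | inj₂ av≡pv = inj₁ (partner-injective (trans (sym au≡pu) (trans eq av≡pv)))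

    position : Fin n → Fin ∣ Lower ∣ × Fin 2
    position v = index (anchor∈Lower v) , side v

    anchor≡ : ∀ {u v} → proj₁ (position u) ≡ proj₁ (position v) → anchor u ≡ anchor v
    anchor≡ {u} {v} eq = trans (sym (enumerate-index (anchor∈Lower u)))
                           (trans (cong (enumerate Lower) eq) (enumerate-index (anchor∈Lower v)))

    position-injective : Injective _≡_ _≡_ position
    position-injective {u} {v} eq with same-anchor (anchor≡ (,-injectiveˡ eq))
    ... | inj₁ u≡v  = u≡v
    ... | inj₂ refl = ⊥-elim (proj₂ (anchor-partner u) (sym (,-injectiveʳ eq)))

    position-at : ∀ {x q s} → anchor x ≡ enumerate Lower q → side x ≡ s → position x ≡ (q , s)
    position-at {x} ax≡w sx≡s =
      cong₂ _,_ (enumerate-injective Lower (trans (enumerate-index (anchor∈Lower x)) ax≡w)) sx≡s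

    position-surjective : ∀ p → ∃ λ x → position x ≡ p
    position-surjective (q , s) with anchor-of-lower (lower⁻ (enumerate-∈ Lower q))
    position-surjective (q , zero)     | aw≡w , sw≡0 = enumerate Lower q , position-at aw≡w sw≡0
    position-surjective (q , suc zero) | aw≡w , sw≡0 = partner w ,
      position-at (trans (proj₁ (anchor-partner w)) aw≡w)
                  (≢⇒opposite (λ 0≡spw → proj₂ (anchor-partner w) (trans (sym 0≡spw) (sym sw≡0))))
      where w = enumerate Lower q

    multipartite : CompleteMultipartite G (toℕ ∘ proj₁ ∘ position)
    multipartite u v = mk⇔
      (λ ¬uv → cong toℕ (enumerate-injective Lower (begin
        enumerate Lower (proj₁ (position u))   ≡⟨ enumerate-index (anchor∈Lower u) ⟩
        anchor u                               ≡⟨ same-pair ¬uv ⟩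
        anchor v                               ≡⟨ enumerate-index (anchor∈Lower v) ⟨
        enumerate Lower (proj₁ (position v))   ∎)))
      (λ eq → [ (λ { refl → irrfl G u }) , (λ { refl → proj₂ (nonAdjacent-partner u) }) ]
                (same-anchor (anchor≡ (toℕ-injective eq))))
      where
      open ≡-Reasoning
      same-pair : adj G u v ≡ false → anchor u ≡ anchor v
      same-pair ¬uv with u ≟ v
      ... | yes refl = refl
      ... | no  u≢v  = trans (sym (proj₁ (anchor-partner u)))
                             (cong anchor (sym (nonAdjacent⇒partner (u≢v , ¬uv))))

  complement⇒iso : Iso G (KminusPM n)
  complement⇒iso = pairing-iso {G = G} position position-injective position-surjective multipartite

module _ {r k} (G : Graph (suc (r + k))) where

  stable⇒complement : 3 ≤ r → MaxDegreeLt G (r + k) → VertexStable (Star r) k G →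
                      ComplementOfPerfectMatching G × Even r
  stable⇒complement 3≤r Δ<r+k stable =
    complementOfPerfectMatching G r<n nonNeighbour dominated 3≤r ,
    r-even G r<n nonNeighbour dominated 3≤r
    where
    r<n          = s≤s (m≤m+n r k)
    nonNeighbour = maxDegree<⇒nonNeighbour G Δ<r+k
    dominated    = vertexStable⇒dominated G stable

  complement⇒stable : Even r → ComplementOfPerfectMatching G →
                      MaxDegreeLt G (r + k) × VertexStable (Star r) k G
  complement⇒stable even-r complement =
    nonNeighbour⇒maxDegree< G (λ v → partner v , nonAdjacent-partner v) ,
    dominated⇒vertexStable G λ ∣S∣≡1+r →
      odd⇒dominated complement (subst Odd (sym ∣S∣≡1+r) (even⇒1+odd even-r))
    where open ComplementOfPerfectMatching complement

lemma2 : (r k : ℕ) → 3 ≤ r →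
    ((Even r × Odd k) →
       ∀ (G : Graph (suc (r + k))) →
         (MaxDegreeLt G (r + k) × VertexStable (Star r) k G)
           ⇔ Iso G (KminusPM (suc (r + k))))
    × ((Odd r ⊎ Even k) →
       ∀ (G : Graph (suc (r + k))) →
         MaxDegreeLt G (r + k) → ¬ VertexStable (Star r) k G)
lemma2 r k 3≤r = characterisation , impossibility
  where
  characterisation : Even r × Odd k → ∀ (G : Graph (suc (r + k))) →
    (MaxDegreeLt G (r + k) × VertexStable (Star r) k G) ⇔ Iso G (KminusPM (suc (r + k)))
  characterisation (even-r , odd-k) G = mk⇔
    (λ stable → complement⇒iso (proj₁ (stable⇒complement G 3≤r (proj₁ stable) (proj₂ stable))))
    (λ iso → complement⇒stable G even-r (iso⇒complement iso (Blocks.KminusPM-complement {h = h} n≡h*2)))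
    where
    even-n = odd⇒1+even (even+odd even-r odd-k)
    h      = proj₁ even-n
    n≡h*2  = trans (proj₂ even-n) (*-comm 2 h)

  impossibility : Odd r ⊎ Even k → ∀ (G : Graph (suc (r + k))) →
    MaxDegreeLt G (r + k) → ¬ VertexStable (Star r) k G
  impossibility odd-r⊎even-k G Δ<r+k stable =
    [ even∧odd⇒⊥ even-r
    , (λ even-k → even∧odd⇒⊥ (even-order complement) (even⇒1+odd (even+even even-r even-k)))
    ] odd-r⊎even-k
    where
    complement = proj₁ (stable⇒complement G 3≤r Δ<r+k stable)
    even-r     = proj₂ (stable⇒complement G 3≤r Δ<r+k stable)
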